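{- For every triple of integers $a,b,c\geq 1$ with no common factor such that $a\mid c$, $b\mid c$, $a<c$ and $b<c$, there is a unique $n\ge 3$ for which there is a smooth arithmetical structure on $D_n$ with $r_x=a$, $r_y=b$, $r_0=c$. Moreover, this smooth arithmetical structure on $D_n$ with $r_x=a$, $r_y=b$, $r_0=c$ is unique.
   Context: For $n\ge 3$ let $\ell=n-3$. The bident $D_n$ has vertices $v_x,v_y,v_0,\dots,v_\ell$ and edges $v_xv_0$, $v_yv_0$, $v_iv_{i+1}$ ($0\le i\le\ell-1$). An arithmetical structure on $D_n$ is a pair $(\mathbf d,\mathbf r)$, $\mathbf d=(d_x,d_y,d_0,\dots,d_\ell)$, $\mathbf r=(r_x,r_y,r_0,\dots,r_\ell)$, of positive integer vectors with $(\operatorname{diag}(\mathbf d)-A)\mathbf r=\mathbf 0$ ($A$ the adjacency matrix) and the entries of $\mathbf r$ having no nontrivial common factor. It is smooth if $d_x,d_y,d_1,\dots,d_\ell\ge2$. -}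

module Defs where

open import Data.Nat using (ℕ; zero; suc; _+_; _*_; _≤_; _<_; _≡ᵇ_)
open import Data.Nat.Divisibility using (_∣_)
open import Data.Bool using (Bool; true; false; _∧_; _∨_; if_then_else_)
open import Data.Fin using (Fin; toℕ) renaming (zero to fz; suc to fs)
open import Data.List using (List; map)
open import Data.Nat.ListAction using (sum)
open import Data.List using () renaming (allFin to allFinL)
open import Data.Product using (_×_)
open import Relation.Binary.PropositionalEquality using (_≡_; _≢_)

-- Vertices of the bident D_n (n = ℓ + 3) are Fin n, with the numbering
--   0 ↦ v_x ,  1 ↦ v_y ,  2 + i ↦ v_i  (0 ≤ i ≤ ℓ).
-- Directed edge relation on labels (one orientation of each edge):
--   v_x v_0 = {0,2},  v_y v_0 = {1,2},  v_i v_{i+1} = {2+i, 3+i}.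
edgeℕ : ℕ → ℕ → Bool
edgeℕ a b = ((a ≡ᵇ 0) ∧ (b ≡ᵇ 2)) ∨ ((a ≡ᵇ 1) ∧ (b ≡ᵇ 2))
          ∨ ((2 Data.Nat.≤ᵇ a) ∧ (b ≡ᵇ suc a))

adjD : (ℓ : ℕ) → Fin (3 + ℓ) → Fin (3 + ℓ) → Bool
adjD ℓ u v = edgeℕ (toℕ u) (toℕ v) ∨ edgeℕ (toℕ v) (toℕ u)

adjSum : (ℓ : ℕ) → (Fin (3 + ℓ) → ℕ) → Fin (3 + ℓ) → ℕ
adjSum ℓ r v = sum (map (λ u → if adjD ℓ v u then r u else 0) (allFinL (3 + ℓ)))

record IsArithStruct (ℓ : ℕ) (d r : Fin (3 + ℓ) → ℕ) : Set where
  field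
    d-pos   : ∀ v → 0 < d v
    r-pos   : ∀ v → 0 < r v
    kernel  : ∀ v → d v * r v ≡ adjSum ℓ r v
    r-prim  : ∀ k → (∀ v → k ∣ r v) → k ≡ 1

IsSmooth : (ℓ : ℕ) → (d : Fin (3 + ℓ) → ℕ) → Set
IsSmooth ℓ d = ∀ v → toℕ v ≢ 2 → 2 ≤ d v

SmoothWith : (ℓ : ℕ) → (a b c : ℕ) → (d r : Fin (3 + ℓ) → ℕ) → Set
SmoothWith ℓ a b c d r =
  IsArithStruct ℓ d r × IsSmooth ℓ d
  × r fz ≡ a × r (fs fz) ≡ b × r (fs (fs fz)) ≡ c

-- Write r_{-1} := a + b (what the two leaves contribute at v₀) and r_{ℓ+1} := 0; the kernel
-- equations along the path v₀ … v_ℓ then read d_i r_i = r_{i-1} + r_{i+1}, and at the leaves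
-- d_x a = d_y b = c.  Smoothness (d_i ≥ 2 for i ≥ 1) forces, by downward induction from
-- r_{ℓ+1} = 0 < r_ℓ, that r_0 > r_1 > ⋯ > r_ℓ > 0.  So r_{i+1} is the residue of −r_{i-1}
-- modulo r_i: the r_i form a Euclid-like chain determined by a + b and c alone, ℓ is the index
-- of its last positive term, and d is recovered by division.  Conversely that chain decreases
-- while positive, so it reaches 0 within c steps, and dividing gives a smooth structure:
-- c / a ≥ 2 as a < c, and (r_{i-1} + r_{i+1}) / r_i ≥ 2 for i ≥ 1 as r_i < r_{i-1}.

module Submission where

open import Algebra.Properties.CommutativeSemigroup using (interchange)
open import Data.Bool using (true; false; _∨_; if_then_else_)
open import Data.Bool.Properties using (∨-identityʳ; T-≡; ¬-not)
open import Data.Empty using (⊥-elim)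
open import Data.Fin using (Fin; toℕ; fromℕ<) renaming (zero to fz; suc to fs)
open import Data.Fin.Properties using (toℕ≤pred[n]; toℕ-fromℕ<)
open import Data.List using (tabulate)
open import Data.List.Properties using (map-tabulate)
open import Data.Nat
open import Data.Nat.DivMod
open import Data.Nat.Divisibility
  using (_∣_; divides; quotient; quotient≢0; quotient>1; m∣n⇒n≡quotient*m; m%n≡0⇒n∣m)
open import Data.Nat.ListAction using (sum)
open import Data.Nat.Properties
open import Data.Nat.Solver using (module +-*-Solver)
open import Data.Product using (Σ; ∃; ∃-syntax; _×_; _,_; proj₁; proj₂)
open import Data.Sum using (inj₁; inj₂)
open import Function using (_∘_; id)
open import Function.Bundles using (Equivalence)
open import Relation.Binary using (tri<; tri≈; tri>)
open import Relation.Binary.PropositionalEquality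
open import Relation.Nullary using (yes; no)

open import Defs

2≤m⇒m*n≡o+p⇒p<n⇒n<o : ∀ {m n o p} → 2 ≤ m → m * n ≡ o + p → p < n → n < o
2≤m⇒m*n≡o+p⇒p<n⇒n<o {m} {n} {o} {p} 2≤m m*n≡o+p p<n = +-cancelʳ-< n n o (begin-strict
  n + n        ≡⟨ cong (n +_) (sym (+-identityʳ n)) ⟩
  2 * n        ≤⟨ *-monoˡ-≤ n 2≤m ⟩
  m * n        ≡⟨ m*n≡o+p ⟩
  o + p        <⟨ +-monoʳ-< o p<n ⟩
  o + n        ∎)
  where open ≤-Reasoning

quotient>0 : ∀ {m n} (m∣n : m ∣ n) → 0 < n → 0 < quotient m∣n
quotient>0 m∣n n>0 = >-nonZero⁻¹ _ {{quotient≢0 m∣n {{>-nonZero n>0}}}}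

-- (−p) mod q; the junk value at q = 0 makes 0 absorbing for `chain` below.
negMod : ℕ → ℕ → ℕ
negMod p zero = 0
negMod p q@(suc _) = (q ∸ p % q) % q

negMod< : ∀ p {q} → 0 < q → negMod p q < q
negMod< p {q@(suc _)} _ = m%n<n (q ∸ p % q) q

∣+negMod : ∀ p {q} → 0 < q → q ∣ p + negMod p q
∣+negMod p {q@(suc _)} _ = m%n≡0⇒n∣m _ q (begin
  (p + y % q) % q          ≡⟨ %-distribˡ-+ p (y % q) q ⟩
  (p % q + y % q % q) % q  ≡⟨ cong (λ z → (p % q + z) % q) (m%n%n≡m%n y q) ⟩
  (p % q + y % q) % q      ≡⟨ cong (λ z → (z + y % q) % q) (sym (m%n%n≡m%n p q)) ⟩
  (p % q % q + y % q) % q  ≡⟨ sym (%-distribˡ-+ (p % q) y q) ⟩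
  (p % q + y) % q          ≡⟨ cong (_% q) (m+[n∸m]≡n (<⇒≤ (m%n<n p q))) ⟩
  q % q                    ≡⟨ n%n≡0 q ⟩
  0                        ∎)
  where
  open ≡-Reasoning
  y : ℕ
  y = q ∸ p % q

∣+-residue-unique : ∀ {p q x y} → x < q → y < q → q ∣ p + x → q ∣ p + y → x ≡ y
∣+-residue-unique {p} {q} {x} {y} x<q y<q q∣p+x q∣p+y = begin
  x                  ≡⟨ sym (m<n⇒m%n≡m x<q) ⟩
  x % q              ≡⟨ sym (%-remove-+ʳ x q∣p+y) ⟩
  (x + (p + y)) % q  ≡⟨ cong (_% q) (swap x p y) ⟩
  (y + (p + x)) % q  ≡⟨ %-remove-+ʳ y q∣p+x ⟩
  y % q              ≡⟨ m<n⇒m%n≡m y<q ⟩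
  y                  ∎
  where
  open ≡-Reasoning
  open +-*-Solver
  instance
    q≢0 : NonZero q
    q≢0 = >-nonZero (≤-<-trans z≤n x<q)
  swap : ∀ x p y → x + (p + y) ≡ y + (p + x)
  swap = solve 3 (λ x p y → x :+ (p :+ y) := y :+ (p :+ x)) refl

negMod-unique : ∀ {p q x} → x < q → q ∣ p + x → negMod p q ≡ x
negMod-unique {p} {q} x<q q∣p+x = ∣+-residue-unique (negMod< p q>0) x<q (∣+negMod p q>0) q∣p+x
  where
  q>0 : 0 < q
  q>0 = ≤-<-trans z≤n x<q

LastPositive : (ℕ → ℕ) → ℕ → Set
LastPositive f L = (∀ i → i ≤ L → 0 < f i) × f (suc L) ≡ 0

lastPositive-unique : ∀ {f L L′} → LastPositive f L → LastPositive f L′ → L ≡ L′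
lastPositive-unique {L = L} {L′} (pos , stop) (pos′ , stop′) with <-cmp L L′
... | tri≈ _ L≡L′ _ = L≡L′
... | tri< L<L′ _ _ = ⊥-elim (<⇒≢ (pos′ (suc L) L<L′) (sym stop))
... | tri> _ _ L′<L = ⊥-elim (<⇒≢ (pos (suc L′) L′<L) (sym stop′))

∃-dropToZero : ∀ {f : ℕ → ℕ} n → 0 < f 0 → f n ≡ 0 → ∃[ L ] (0 < f L × f (suc L) ≡ 0)
∃-dropToZero zero f0>0 f0≡0 = ⊥-elim (<⇒≢ f0>0 (sym f0≡0))
∃-dropToZero {f} (suc n) f0>0 fn≡0 with f 1 ≟ 0
... | yes f1≡0 = 0 , f0>0 , f1≡0
... | no f1≢0 with ∃-dropToZero {f ∘ suc} n (n≢0⇒n>0 f1≢0) fn≡0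
...   | L , fL>0 , stop = suc L , fL>0 , stop

module _ {f : ℕ → ℕ} (absorb : ∀ i → f i ≡ 0 → f (suc i) ≡ 0) where

  vanishes-beyond : ∀ {m k} → m ≤ k → f m ≡ 0 → f k ≡ 0
  vanishes-beyond {k = zero}  z≤n fm≡0 = fm≡0
  vanishes-beyond {k = suc k} m≤1+k fm≡0 with m≤n⇒m<n∨m≡n m≤1+k
  ... | inj₁ (s≤s m≤k) = absorb k (vanishes-beyond m≤k fm≡0)
  ... | inj₂ refl = fm≡0

  positive-below : ∀ {L} → 0 < f L → ∀ i → i ≤ L → 0 < f i
  positive-below fL>0 i i≤L = n≢0⇒n>0 (λ fi≡0 → <⇒≢ fL>0 (sym (vanishes-beyond i≤L fi≡0)))

  ∃-lastPositive : ∀ n → 0 < f 0 → f n ≡ 0 → ∃ (LastPositive f)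
  ∃-lastPositive n f0>0 fn≡0 with ∃-dropToZero n f0>0 fn≡0
  ... | L , fL>0 , stop = L , positive-below fL>0 , stop

  module _ (decrease : ∀ i → 0 < f i → f (suc i) < f i) where

    f[i]≤f[0]∸i : ∀ i → f i ≤ f 0 ∸ i
    f[i]≤f[0]∸i zero = ≤-refl
    f[i]≤f[0]∸i (suc i) with f i ≟ 0
    ... | yes fi≡0 = subst (_≤ f 0 ∸ suc i) (sym (absorb i fi≡0)) z≤n
    ... | no fi≢0 = begin
      f (suc i)      ≤⟨ <⇒≤pred (<-≤-trans (decrease i (n≢0⇒n>0 fi≢0)) (f[i]≤f[0]∸i i)) ⟩
      pred (f 0 ∸ i) ≡⟨ pred[m∸n]≡m∸[1+n] (f 0) i ⟩
      f 0 ∸ suc i    ∎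
      where open ≤-Reasoning

    f[f[0]]≡0 : f (f 0) ≡ 0
    f[f[0]]≡0 = n≤0⇒n≡0 (subst (f (f 0) ≤_) (n∸n≡0 (f 0)) (f[i]≤f[0]∸i (f 0)))

downward-induction : ∀ {P : ℕ → Set} ℓ → P ℓ → (∀ i → i < ℓ → P (suc i) → P i) → ∀ i → i ≤ ℓ → P i
downward-induction zero    Pℓ step .zero z≤n = Pℓ
downward-induction (suc ℓ) Pℓ step i i≤1+ℓ with m≤n⇒m<n∨m≡n i≤1+ℓ
... | inj₂ refl = Pℓ
... | inj₁ (s≤s i≤ℓ) =
  downward-induction ℓ (step ℓ ≤-refl Pℓ) (λ j j<ℓ → step j (m<n⇒m<1+n j<ℓ)) i i≤ℓ

preceding : ℕ → (ℕ → ℕ) → ℕ → ℕ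
preceding p₀ t zero    = p₀
preceding p₀ t (suc i) = t i

module Chain (p₀ c : ℕ) where

  -- chain i is r_i and before i is r_{i-1}, with p₀ in the role of r_{-1}.
  mutual
    chain : ℕ → ℕ
    chain zero    = c
    chain (suc i) = negMod (before i) (chain i)

    before : ℕ → ℕ
    before zero    = p₀
    before (suc i) = chain i

  preceding-chain : ∀ i → preceding p₀ chain i ≡ before i
  preceding-chain zero    = refl
  preceding-chain (suc i) = refl

  chain-decreasing : ∀ i → 0 < chain i → chain (suc i) < chain i
  chain-decreasing i = negMod< (before i)

  chain-divisible : ∀ i → 0 < chain i → chain i ∣ before i + chain (suc i)
  chain-divisible i = ∣+negMod (before i)

  chain-absorbing : ∀ i → chain i ≡ 0 → chain (suc i) ≡ 0
  chain-absorbing i = cong (negMod (before i))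

  ∃-lastPositive-chain : 0 < c → ∃ (LastPositive chain)
  ∃-lastPositive-chain c>0 =
    ∃-lastPositive chain-absorbing c c>0 (f[f[0]]≡0 chain-absorbing chain-decreasing)

  record IsChain (t : ℕ → ℕ) (L : ℕ) : Set where
    field
      starts     : t 0 ≡ c
      stops      : t (suc L) ≡ 0
      decreasing : ∀ i → i ≤ L → t (suc i) < t i
      divisible  : ∀ i → i ≤ L → t i ∣ preceding p₀ t i + t (suc i)

  module _ {t : ℕ → ℕ} {L : ℕ} (isChain : IsChain t L) where
    open IsChain isChain

    private
      positive : ∀ i → i ≤ L → 0 < t i
      positive i i≤L = ≤-<-trans z≤n (decreasing i i≤L)

      next : ∀ i → i ≤ L → preceding p₀ t i ≡ before i × t i ≡ chain i → t (suc i) ≡ chain (suc i)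
      next i i≤L (p≡ , t≡) = sym (negMod-unique
        (subst (t (suc i) <_) t≡ (decreasing i i≤L))
        (subst₂ (λ q p → q ∣ p + t (suc i)) t≡ p≡ (divisible i i≤L)))

      agree : ∀ i → i ≤ L → preceding p₀ t i ≡ before i × t i ≡ chain i
      agree zero    _     = refl , starts
      agree (suc i) 1+i≤L = proj₂ previous , next i (<⇒≤ 1+i≤L) previous
        where
        previous : preceding p₀ t i ≡ before i × t i ≡ chain i
        previous = agree i (<⇒≤ 1+i≤L)

    IsChain⇒≡chain : ∀ i → i ≤ suc L → t i ≡ chain i
    IsChain⇒≡chain i i≤1+L with m≤n⇒m<n∨m≡n i≤1+L
    ... | inj₁ (s≤s i≤L) = proj₂ (agree i i≤L)
    ... | inj₂ refl      = next L ≤-refl (agree L ≤-refl)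

    IsChain⇒lastPositive : LastPositive chain L
    IsChain⇒lastPositive =
      (λ i i≤L → subst (0 <_) (IsChain⇒≡chain i (m≤n⇒m≤1+n i≤L)) (positive i i≤L)) ,
      trans (sym (IsChain⇒≡chain (suc L) ≤-refl)) stops

sumBelow : ℕ → (ℕ → ℕ) → ℕ
sumBelow zero    f = 0
sumBelow (suc n) f = f 0 + sumBelow n (f ∘ suc)

sum-tabulate≡sumBelow : ∀ n {g : Fin n → ℕ} (f : ℕ → ℕ) → (∀ u → g u ≡ f (toℕ u)) →
                        sum (tabulate g) ≡ sumBelow n f
sum-tabulate≡sumBelow zero    f g≗f = refl
sum-tabulate≡sumBelow (suc n) f g≗f =
  cong₂ _+_ (g≗f fz) (sum-tabulate≡sumBelow n (f ∘ suc) (g≗f ∘ fs))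

sumBelow-cong : ∀ n {f g : ℕ → ℕ} → (∀ k → f k ≡ g k) → sumBelow n f ≡ sumBelow n g
sumBelow-cong zero    f≗g = refl
sumBelow-cong (suc n) f≗g = cong₂ _+_ (f≗g 0) (sumBelow-cong n (f≗g ∘ suc))

sumBelow-+ : ∀ n (f g : ℕ → ℕ) → sumBelow n (λ k → f k + g k) ≡ sumBelow n f + sumBelow n g
sumBelow-+ zero    f g = refl
sumBelow-+ (suc n) f g =
  trans (cong (f 0 + g 0 +_) (sumBelow-+ n (f ∘ suc) (g ∘ suc)))
        (interchange +-commutativeSemigroup (f 0) (g 0) _ _)

sumBelow-zero : ∀ n → sumBelow n (λ _ → 0) ≡ 0
sumBelow-zero zero    = refl
sumBelow-zero (suc n) = sumBelow-zero n

indicator : ℕ → (ℕ → ℕ) → ℕ → ℕ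
indicator j f k = if k ≡ᵇ j then f k else 0

sumBelow-indicator : ∀ n j {f : ℕ → ℕ} → (∀ k → n ≤ k → f k ≡ 0) → sumBelow n (indicator j f) ≡ f j
sumBelow-indicator zero    j       f-vanishes = sym (f-vanishes j z≤n)
sumBelow-indicator (suc n) zero    f-vanishes = trans (cong (_ +_) (sumBelow-zero n)) (+-identityʳ _)
sumBelow-indicator (suc n) (suc j) f-vanishes =
  sumBelow-indicator n j (λ k n≤k → f-vanishes (suc k) (s≤s n≤k))

≡ᵇ-refl : ∀ n → (n ≡ᵇ n) ≡ true
≡ᵇ-refl n = Equivalence.to T-≡ (≡⇒≡ᵇ n n refl)

≢⇒≡ᵇ-false : ∀ {m n} → m ≢ n → (m ≡ᵇ n) ≡ false
≢⇒≡ᵇ-false {m} {n} m≢n = ¬-not (λ m≡ᵇn → m≢n (≡ᵇ⇒≡ m n (Equivalence.from T-≡ m≡ᵇn)))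

neighbourSum : (ℕ → ℕ) → ℕ → ℕ
neighbourSum G 0 = G 2
neighbourSum G 1 = G 2
neighbourSum G 2 = G 0 + G 1 + G 3
neighbourSum G (suc (suc (suc i))) = G (2 + i) + G (4 + i)

adjacentPart : (ℕ → ℕ) → ℕ → ℕ → ℕ
adjacentPart G m k = if edgeℕ m k ∨ edgeℕ k m then G k else 0

adjacentPart-leaf : ∀ G m k → m < 2 → adjacentPart G m k ≡ indicator 2 G k
adjacentPart-leaf G 0 0 _ = refl
adjacentPart-leaf G 0 1 _ = refl
adjacentPart-leaf G 0 2 _ = refl
adjacentPart-leaf G 0 (suc (suc (suc k))) _ = refl
adjacentPart-leaf G 1 0 _ = refl
adjacentPart-leaf G 1 1 _ = refl
adjacentPart-leaf G 1 2 _ = refl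
adjacentPart-leaf G 1 (suc (suc (suc k))) _ = refl
adjacentPart-leaf G (suc (suc m)) k (s≤s (s≤s ()))

adjacentPart-root : ∀ G k → adjacentPart G 2 k ≡ indicator 0 G k + indicator 1 G k + indicator 3 G k
adjacentPart-root G 0 = sym (trans (+-identityʳ _) (+-identityʳ _))
adjacentPart-root G 1 = sym (+-identityʳ _)
adjacentPart-root G 2 = refl
adjacentPart-root G 3 = refl
adjacentPart-root G (suc (suc (suc (suc k)))) = refl

adjacentPart-path : ∀ G i k → adjacentPart G (3 + i) k ≡ indicator (2 + i) G k + indicator (4 + i) G k
adjacentPart-path G i 0 = refl
adjacentPart-path G i 1 = refl
adjacentPart-path G i (suc (suc k)) with k ≟ i
... | yes refl rewrite ≡ᵇ-refl i | ≢⇒≡ᵇ-false (m≢1+n+m i {1}) = sym (+-identityʳ _)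
... | no k≢i rewrite ≢⇒≡ᵇ-false k≢i | ≢⇒≡ᵇ-false (k≢i ∘ sym) | ∨-identityʳ (k ≡ᵇ 2 + i) = refl

sumBelow-adjacentPart : ∀ n m {G : ℕ → ℕ} → (∀ k → n ≤ k → G k ≡ 0) →
                        sumBelow n (adjacentPart G m) ≡ neighbourSum G m
sumBelow-adjacentPart n 0 {G} G-vanishes =
  trans (sumBelow-cong n (λ k → adjacentPart-leaf G 0 k z<s)) (sumBelow-indicator n 2 G-vanishes)
sumBelow-adjacentPart n 1 {G} G-vanishes =
  trans (sumBelow-cong n (λ k → adjacentPart-leaf G 1 k (s<s z<s))) (sumBelow-indicator n 2 G-vanishes)
sumBelow-adjacentPart n 2 {G} G-vanishes = begin
  sumBelow n (adjacentPart G 2)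
    ≡⟨ sumBelow-cong n (adjacentPart-root G) ⟩
  sumBelow n (λ k → indicator 0 G k + indicator 1 G k + indicator 3 G k)
    ≡⟨ sumBelow-+ n _ _ ⟩
  sumBelow n (λ k → indicator 0 G k + indicator 1 G k) + sumBelow n (indicator 3 G)
    ≡⟨ cong (_+ sumBelow n (indicator 3 G)) (sumBelow-+ n _ _) ⟩
  sumBelow n (indicator 0 G) + sumBelow n (indicator 1 G) + sumBelow n (indicator 3 G)
    ≡⟨ cong₂ _+_ (cong₂ _+_ (indicator-sum 0) (indicator-sum 1)) (indicator-sum 3) ⟩
  G 0 + G 1 + G 3 ∎
  where
  open ≡-Reasoning
  indicator-sum : ∀ j → sumBelow n (indicator j G) ≡ G j
  indicator-sum j = sumBelow-indicator n j G-vanishes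
sumBelow-adjacentPart n (suc (suc (suc i))) {G} G-vanishes = begin
  sumBelow n (adjacentPart G (3 + i))
    ≡⟨ sumBelow-cong n (adjacentPart-path G i) ⟩
  sumBelow n (λ k → indicator (2 + i) G k + indicator (4 + i) G k)
    ≡⟨ sumBelow-+ n _ _ ⟩
  sumBelow n (indicator (2 + i) G) + sumBelow n (indicator (4 + i) G)
    ≡⟨ cong₂ _+_ (indicator-sum (2 + i)) (indicator-sum (4 + i)) ⟩
  G (2 + i) + G (4 + i) ∎
  where
  open ≡-Reasoning
  indicator-sum : ∀ j → sumBelow n (indicator j G) ≡ G j
  indicator-sum j = sumBelow-indicator n j G-vanishes

adjSum≡neighbourSum : ∀ ℓ (r : Fin (3 + ℓ) → ℕ) (G : ℕ → ℕ) → (∀ u → r u ≡ G (toℕ u)) →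
                      (∀ k → 3 + ℓ ≤ k → G k ≡ 0) → ∀ v → adjSum ℓ r v ≡ neighbourSum G (toℕ v)
adjSum≡neighbourSum ℓ r G r≗G G-vanishes v = begin
  adjSum ℓ r v
    ≡⟨ cong sum (map-tabulate id term) ⟩
  sum (tabulate term)
    ≡⟨ sum-tabulate≡sumBelow (3 + ℓ) (adjacentPart G (toℕ v)) term≗adjacentPart ⟩
  sumBelow (3 + ℓ) (adjacentPart G (toℕ v))
    ≡⟨ sumBelow-adjacentPart (3 + ℓ) (toℕ v) G-vanishes ⟩
  neighbourSum G (toℕ v)
    ∎
  where
  open ≡-Reasoning
  term : Fin (3 + ℓ) → ℕ
  term u = if adjD ℓ v u then r u else 0
  term≗adjacentPart : ∀ u → term u ≡ adjacentPart G (toℕ v) (toℕ u)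
  term≗adjacentPart u with adjD ℓ v u
  ... | true  = r≗G u
  ... | false = refl

neighbourSum-path : ∀ (G : ℕ → ℕ) i →
                    neighbourSum G (2 + i) ≡ preceding (G 0 + G 1) (G ∘ (2 +_)) i + G (3 + i)
neighbourSum-path G zero    = refl
neighbourSum-path G (suc i) = refl

-- Zero past the end of the vector: this is the r_{ℓ+1} = 0 of the recurrence.
extend : ∀ {n} → (Fin n → ℕ) → ℕ → ℕ
extend {zero}  r k       = 0
extend {suc n} r zero    = r fz
extend {suc n} r (suc k) = extend (r ∘ fs) k

extend-toℕ : ∀ {n} (r : Fin n → ℕ) u → extend r (toℕ u) ≡ r u
extend-toℕ r fz     = refl
extend-toℕ r (fs u) = extend-toℕ (r ∘ fs) u

extend-≥ : ∀ {n} (r : Fin n → ℕ) k → n ≤ k → extend r k ≡ 0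
extend-≥ {zero}  r k       _         = refl
extend-≥ {suc n} r (suc k) (s≤s n≤k) = extend-≥ (r ∘ fs) k n≤k

module Bident (a b c : ℕ) where

  open Chain (a + b) c public

  module FromStructure {ℓ : ℕ} {d r : Fin (3 + ℓ) → ℕ} (S : SmoothWith ℓ a b c d r) where
    open IsArithStruct (proj₁ S)

    isSmooth : IsSmooth ℓ d
    isSmooth = proj₁ (proj₂ S)

    rx≡a : r fz ≡ a
    rx≡a = proj₁ (proj₂ (proj₂ S))

    ry≡b : r (fs fz) ≡ b
    ry≡b = proj₁ (proj₂ (proj₂ (proj₂ S)))

    r₀≡c : r (fs (fs fz)) ≡ c
    r₀≡c = proj₂ (proj₂ (proj₂ (proj₂ S)))

    path : ℕ → ℕ
    path i = extend r (2 + i)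

    pathVertex : ∀ {i} → i ≤ ℓ → Fin (3 + ℓ)
    pathVertex i≤ℓ = fs (fs (fromℕ< (s≤s i≤ℓ)))

    toℕ-pathVertex : ∀ {i} (i≤ℓ : i ≤ ℓ) → toℕ (pathVertex i≤ℓ) ≡ 2 + i
    toℕ-pathVertex i≤ℓ = cong (2 +_) (toℕ-fromℕ< (s≤s i≤ℓ))

    path≡r : ∀ {i} (i≤ℓ : i ≤ ℓ) → path i ≡ r (pathVertex i≤ℓ)
    path≡r i≤ℓ = trans (cong (extend r) (sym (toℕ-pathVertex i≤ℓ))) (extend-toℕ r _)

    kernel-path : ∀ {i} (i≤ℓ : i ≤ ℓ) →
                  d (pathVertex i≤ℓ) * path i ≡ preceding (a + b) path i + path (suc i)
    kernel-path {i} i≤ℓ = begin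
      d v * path i
        ≡⟨ cong (d v *_) (path≡r i≤ℓ) ⟩
      d v * r v
        ≡⟨ kernel v ⟩
      adjSum ℓ r v
        ≡⟨ adjSum≡neighbourSum ℓ r (extend r) (sym ∘ extend-toℕ r) (extend-≥ r) v ⟩
      neighbourSum (extend r) (toℕ v)
        ≡⟨ cong (neighbourSum (extend r)) (toℕ-pathVertex i≤ℓ) ⟩
      neighbourSum (extend r) (2 + i)
        ≡⟨ neighbourSum-path (extend r) i ⟩
      preceding (r fz + r (fs fz)) path i + path (suc i)
        ≡⟨ cong (λ p → preceding p path i + path (suc i)) (cong₂ _+_ rx≡a ry≡b) ⟩
      preceding (a + b) path i + path (suc i)
        ∎
      where
      open ≡-Reasoning
      v : Fin (3 + ℓ)
      v = pathVertex i≤ℓ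

    path-positive : ∀ i → i ≤ ℓ → 0 < path i
    path-positive i i≤ℓ = subst (0 <_) (sym (path≡r i≤ℓ)) (r-pos _)

    path-stops : path (suc ℓ) ≡ 0
    path-stops = extend-≥ r (3 + ℓ) ≤-refl

    path-decreasing : ∀ i → i ≤ ℓ → path (suc i) < path i
    path-decreasing = downward-induction ℓ
      (subst (_< path ℓ) (sym path-stops) (path-positive ℓ ≤-refl))
      (λ i i<ℓ → 2≤m⇒m*n≡o+p⇒p<n⇒n<o (isSmooth _ (not-root i<ℓ)) (kernel-path i<ℓ))
      where
      not-root : ∀ {i} (1+i≤ℓ : suc i ≤ ℓ) → toℕ (pathVertex 1+i≤ℓ) ≢ 2
      not-root 1+i≤ℓ eq with trans (sym (toℕ-pathVertex 1+i≤ℓ)) eq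
      ... | ()

    isChain : IsChain path ℓ
    isChain = record
      { starts     = r₀≡c
      ; stops      = path-stops
      ; decreasing = path-decreasing
      ; divisible  = λ i i≤ℓ → divides (d (pathVertex i≤ℓ)) (sym (kernel-path i≤ℓ))
      }

  smooth⇒lastPositive : ∀ {ℓ} {d r : Fin (3 + ℓ) → ℕ} →
                        SmoothWith ℓ a b c d r → LastPositive chain ℓ
  smooth⇒lastPositive S = IsChain⇒lastPositive (FromStructure.isChain S)

  module Construction (a≥1 : 1 ≤ a) (b≥1 : 1 ≤ b)
                      (coprime : ∀ k → k ∣ a → k ∣ b → k ∣ c → k ≡ 1)
                      (a∣c : a ∣ c) (b∣c : b ∣ c) (a<c : a < c) (b<c : b < c)
                      {L : ℕ} (lastPositive : LastPositive chain L) where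

    chain-positive : ∀ i → i ≤ L → 0 < chain i
    chain-positive = proj₁ lastPositive

    values : ℕ → ℕ
    values 0             = a
    values 1             = b
    values (suc (suc i)) = chain i

    values-vanish : ∀ k → 3 + L ≤ k → values k ≡ 0
    values-vanish (suc (suc i)) (s≤s (s≤s 1+L≤i)) =
      vanishes-beyond chain-absorbing 1+L≤i (proj₂ lastPositive)

    before-positive : ∀ i → i ≤ L → 0 < before i
    before-positive zero    _     = ≤-trans a≥1 (m≤m+n a b)
    before-positive (suc i) 1+i≤L = chain-positive i (<⇒≤ 1+i≤L)

    path-divisible : ∀ (w : Fin (suc L)) → chain (toℕ w) ∣ before (toℕ w) + chain (suc (toℕ w))
    path-divisible w = chain-divisible (toℕ w) (chain-positive (toℕ w) (toℕ≤pred[n] w))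

    r d : Fin (3 + L) → ℕ
    r = values ∘ toℕ
    d fz          = quotient a∣c
    d (fs fz)     = quotient b∣c
    d (fs (fs w)) = quotient (path-divisible w)

    neighbourSum-values : ∀ v → d v * r v ≡ neighbourSum values (toℕ v)
    neighbourSum-values fz          = sym (m∣n⇒n≡quotient*m a∣c)
    neighbourSum-values (fs fz)     = sym (m∣n⇒n≡quotient*m b∣c)
    neighbourSum-values (fs (fs w)) = begin
      d (fs (fs w)) * chain i                  ≡⟨ sym (m∣n⇒n≡quotient*m (path-divisible w)) ⟩
      before i + chain (suc i)                 ≡⟨ cong (_+ chain (suc i)) (sym (preceding-chain i)) ⟩
      preceding (a + b) chain i + chain (suc i) ≡⟨ sym (neighbourSum-path values i) ⟩
      neighbourSum values (2 + i)              ∎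
      where
      open ≡-Reasoning
      i : ℕ
      i = toℕ w

    adjSum-values : ∀ {r′ : Fin (3 + L) → ℕ} → (∀ v → r′ v ≡ r v) →
                    ∀ v → adjSum L r′ v ≡ neighbourSum values (toℕ v)
    adjSum-values r′≗r = adjSum≡neighbourSum L _ values r′≗r values-vanish

    r-pos : ∀ v → 0 < r v
    r-pos fz          = a≥1
    r-pos (fs fz)     = b≥1
    r-pos (fs (fs w)) = chain-positive (toℕ w) (toℕ≤pred[n] w)

    d-pos : ∀ v → 0 < d v
    d-pos fz          = quotient>0 a∣c (≤-<-trans z≤n a<c)
    d-pos (fs fz)     = quotient>0 b∣c (≤-<-trans z≤n b<c)
    d-pos (fs (fs w)) =
      quotient>0 (path-divisible w) (≤-trans (before-positive (toℕ w) (toℕ≤pred[n] w)) (m≤m+n _ _))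

    smooth : IsSmooth L d
    smooth fz               _    = quotient>1 a∣c a<c
    smooth (fs fz)          _    = quotient>1 b∣c b<c
    smooth (fs (fs fz))     2≢2  = ⊥-elim (2≢2 refl)
    smooth (fs (fs (fs w))) _    = quotient>1 (path-divisible (fs w))
      (≤-trans (chain-decreasing j (chain-positive j (<⇒≤ (toℕ≤pred[n] (fs w))))) (m≤m+n _ _))
      where
      j : ℕ
      j = toℕ w

    smoothWith : SmoothWith L a b c d r
    smoothWith = record
      { d-pos  = d-pos
      ; r-pos  = r-pos
      ; kernel = λ v → trans (neighbourSum-values v) (sym (adjSum-values (λ _ → refl) v))
      ; r-prim = λ k k∣r → coprime k (k∣r fz) (k∣r (fs fz)) (k∣r (fs (fs fz)))
      } , smooth , refl , refl , refl

    unique : ∀ (d′ r′ : Fin (3 + L) → ℕ) → SmoothWith L a b c d′ r′ →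
             (∀ v → d′ v ≡ d v) × (∀ v → r′ v ≡ r v)
    unique d′ r′ S′ = d′≗d , r′≗r
      where
      open FromStructure S′ using (rx≡a; ry≡b; isChain)
      r′≗r : ∀ v → r′ v ≡ r v
      r′≗r fz          = rx≡a
      r′≗r (fs fz)     = ry≡b
      r′≗r (fs (fs w)) = trans (sym (extend-toℕ r′ (fs (fs w))))
                               (IsChain⇒≡chain isChain (toℕ w) (m≤n⇒m≤1+n (toℕ≤pred[n] w)))
      d′≗d : ∀ v → d′ v ≡ d v
      d′≗d v = *-cancelʳ-≡ (d′ v) (d v) (r v) {{>-nonZero (r-pos v)}} (begin
        d′ v * r v                 ≡⟨ cong (d′ v *_) (sym (r′≗r v)) ⟩
        d′ v * r′ v                ≡⟨ IsArithStruct.kernel (proj₁ S′) v ⟩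
        adjSum L r′ v              ≡⟨ adjSum-values r′≗r v ⟩
        neighbourSum values (toℕ v) ≡⟨ sym (neighbourSum-values v) ⟩
        d v * r v                  ∎)
        where open ≡-Reasoning

proposition2p4 : (a b c : ℕ) → 1 ≤ a → 1 ≤ b → 1 ≤ c
    → (∀ k → k ∣ a → k ∣ b → k ∣ c → k ≡ 1)
    → a ∣ c → b ∣ c → a < c → b < c
    → Σ ℕ (λ ℓ → Σ (Fin (3 + ℓ) → ℕ) (λ d → Σ (Fin (3 + ℓ) → ℕ) (λ r →
        SmoothWith ℓ a b c d r
        × (∀ ℓ′ (d′ r′ : Fin (3 + ℓ′) → ℕ) → SmoothWith ℓ′ a b c d′ r′ → ℓ′ ≡ ℓ)
        × (∀ (d′ r′ : Fin (3 + ℓ) → ℕ) → SmoothWith ℓ a b c d′ r′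
             → (∀ v → d′ v ≡ d v) × (∀ v → r′ v ≡ r v)))))
proposition2p4 a b c a≥1 b≥1 c≥1 coprime a∣c b∣c a<c b<c
  with Bident.∃-lastPositive-chain a b c c≥1
... | L , lastPositive = L , d , r , smoothWith , length-unique , unique
  where
  open Bident a b c
  open Construction a≥1 b≥1 coprime a∣c b∣c a<c b<c lastPositive
  length-unique : ∀ ℓ′ (d′ r′ : Fin (3 + ℓ′) → ℕ) → SmoothWith ℓ′ a b c d′ r′ → ℓ′ ≡ L
  length-unique ℓ′ d′ r′ S′ = lastPositive-unique (smooth⇒lastPositive S′) lastPositive
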